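{- Let $A$ be a $\{ -,\triangleright\}$-algebra satisfying (Ax.1)–(Ax.5), let $\mu$ be a maximal filter of $A$ and $F$ any filter of $A$. If the filter $(\mu\triangleright F)^{\uparrow}$ is proper, then it is maximal. Moreover, $(\mu\triangleright F)^{\uparrow}$ is maximal if and only if $\mu\preceq F$, if and only if $\mu\approx(\mu\triangleright F)^{\uparrow}$.
   Context: A $\{ -,\triangleright\}$-algebra is a set $A$ with binary operations $-,\triangleright$. Write $a\cdot b:=a-(a-b)$. Axioms: (Ax.1) $a-(b-a)=a$; (Ax.2) $a\cdot b=b\cdot a$; (Ax.3) $(a-b)-c=(a-c)-b$; (Ax.4) $(a\triangleright c)\cdot(b\triangleright c)=(a\triangleright b)\triangleright c$; (Ax.5) $(a\cdot b)\triangleright a=a\cdot b$. Then $(A,\cdot)$ is a meet-semilattice ordered by $a\le b\iff a\cdot b=a$ with bottom $0=a-a$. A filter is a nonempty upward closed subset closed under $\cdot$; it is proper if $\neq A$; maximal if proper and maximal among proper filters. For $S,T\subseteq A$, $S\triangleright T=\{s\triangleright t\mid s\in S,t\in T\}$ and $S^{\uparrow}$ is its upward closure (for filters $F,G$, $(G\triangleright F)^{\uparrow}$ is a filter). For filters $F,G$: $F\preceq G\iff G\triangleright F\subseteq F$, and $F\approx G\iff F\preceq G\text{ and }G\preceq F$. -}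

module Defs where

open import Level using (Level; _⊔_; suc)
open import Relation.Binary.PropositionalEquality using (_≡_)
open import Data.Product using (Σ; _×_; ∃; ∃-syntax; _,_)
open import Relation.Nullary using (¬_)

record MinusTriAlgebra (ℓ : Level) : Set (suc ℓ) where
  infixl 6 _-_
  infixl 5 _▷_
  infixl 7 _·_
  field
    Carrier : Set ℓ
    _-_ : Carrier → Carrier → Carrier
    _▷_ : Carrier → Carrier → Carrier

  _·_ : Carrier → Carrier → Carrier
  a · b = a - (a - b)

  field
    ax1 : ∀ a b → a - (b - a) ≡ a
    ax2 : ∀ a b → a · b ≡ b · a
    ax3 : ∀ a b c → (a - b) - c ≡ (a - c) - b
    ax4 : ∀ a b c → (a ▷ c) · (b ▷ c) ≡ (a ▷ b) ▷ c
    ax5 : ∀ a b → (a · b) ▷ a ≡ a · b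

  _≤_ : Carrier → Carrier → Set ℓ
  a ≤ b = a · b ≡ a

  Subset : Set (suc ℓ)
  Subset = Carrier → Set ℓ

  _⊆_ : Subset → Subset → Set ℓ
  S ⊆ T = ∀ x → S x → T x

  record IsFilter (F : Subset) : Set ℓ where
    field
      nonempty : ∃[ a ] F a
      upward   : ∀ a b → F a → a ≤ b → F b
      meet     : ∀ a b → F a → F b → F (a · b)

  IsProper : Subset → Set ℓ
  IsProper F = ∃[ a ] ¬ F a

  IsMaximal : Subset → Set (suc ℓ)
  IsMaximal F = IsFilter F × IsProper F ×
    (∀ (G : Subset) → IsFilter G → IsProper G → F ⊆ G → G ⊆ F)

  _▷ₛ_ : Subset → Subset → Subset
  (S ▷ₛ T) x = ∃[ s ] ∃[ t ] (S s × T t × s ▷ t ≡ x)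

  _↑ : Subset → Subset
  (S ↑) x = ∃[ y ] (S y × y ≤ x)

  _⪯_ : Subset → Subset → Set ℓ
  F ⪯ G = (G ▷ₛ F) ⊆ F

  _≈ₛ_ : Subset → Subset → Set ℓ
  F ≈ₛ G = (F ⪯ G) × (G ⪯ F)

-- In a maximal filter μ, an element e belongs to μ unless n · e = 0 for some n ∈ μ:
-- otherwise μ and e generate a proper filter. For m ∈ μ, (n · m) · (k ▷ m) = k ▷ (n · m),
-- and x ▷ y = 0 iff y ▷ x = 0, so k ▷ m ∈ μ unless n ▷ k = 0 for some n ∈ μ.
-- Let G = (μ ▷ F)↑ be proper, H ⊇ G a proper filter and h ∈ H. For m ∈ μ, f ∈ F the
-- element k = (m ▷ f) · h ≤ f satisfies k · (n ▷ f) = n ▷ k, and k · (n ▷ f) ∈ H,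
-- so n ▷ k ≠ 0 for n ∈ μ; hence k ▷ m ∈ μ and h ≥ k = (k ▷ m) ▷ f ∈ G, so G is maximal.
-- The same criterion gives f ▷ m ∈ μ when G is proper, i.e. μ ⪯ F; conversely, under
-- μ ⪯ F a zero m ▷ f = 0 would put m · (f ▷ m) = (m ▷ f) ▷ m = 0 into μ.
-- Finally μ is closed under ▷ (as m · n ≤ n ▷ m), and with ▷ monotone this yields μ ≈ G.
module Submission where

open import Defs
open import Level using (Level)
open import Data.Product using (_×_; _,_; proj₁; proj₂; ∃-syntax)
open import Function.Base using (_∘_)
open import Function.Bundles using (_⇔_; mk⇔)
open import Relation.Binary.PropositionalEquality using (_≡_; refl; sym; trans; cong; subst)
open import Relation.Nullary using (¬_)

module Properties {ℓ : Level} (A : MinusTriAlgebra ℓ) where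
  open MinusTriAlgebra A
  open Relation.Binary.PropositionalEquality.≡-Reasoning

  x-x≡y-y : ∀ x y → x - x ≡ y - y
  x-x≡y-y x y = begin
    x - x                                           ≡⟨ cong (x -_) (sym (ax1 x (x - y))) ⟩
    x - (x - ((x - y) - x))                         ≡⟨ ax2 x ((x - y) - x) ⟩
    ((x - y) - x) - (((x - y) - x) - x)             ≡⟨ cong (λ h → h - (((x - y) - x) - x)) (ax3 x y x) ⟩
    ((x - x) - y) - (((x - y) - x) - x)             ≡⟨ cong (λ h → ((x - x) - y) - (((x - y) - x) - h)) (sym (ax1 x (x - y))) ⟩
    ((x - x) - y) - (((x - y) - x) - (x - ((x - y) - x))) ≡⟨ cong (((x - x) - y) -_) (ax1 ((x - y) - x) x) ⟩
    ((x - x) - y) - ((x - y) - x)                   ≡⟨ cong (((x - x) - y) -_) (sym (ax3 x x y)) ⟩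
    ((x - x) - y) - ((x - x) - y)                   ≡⟨ cong (((x - x) - y) -_) (sym (ax1 ((x - x) - y) y)) ⟩
    ((x - x) - y) - (((x - x) - y) - (y - ((x - x) - y))) ≡⟨ cong (λ h → ((x - x) - y) - (((x - x) - y) - h)) (ax1 y (x - x)) ⟩
    ((x - x) - y) - (((x - x) - y) - y)             ≡⟨ sym (ax2 y ((x - x) - y)) ⟩
    y - (y - ((x - x) - y))                         ≡⟨ cong (y -_) (ax1 y (x - x)) ⟩
    y - y                                           ∎

  x-[y-y]≡x : ∀ x y → x - (y - y) ≡ x
  x-[y-y]≡x x y = begin
    x - (y - y)                                     ≡⟨ cong (λ h → x - (y - h)) (sym (ax1 y (x - x))) ⟩
    x - (y - (y - ((x - x) - y)))                   ≡⟨ cong (x -_) (ax2 y ((x - x) - y)) ⟩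
    x - (((x - x) - y) - (((x - x) - y) - y))       ≡⟨ cong (λ h → x - (h - (((x - x) - y) - y))) (ax3 x x y) ⟩
    x - (((x - y) - x) - (((x - x) - y) - y))       ≡⟨ cong (x -_) (ax3 (x - y) x (((x - x) - y) - y)) ⟩
    x - (((x - y) - (((x - x) - y) - y)) - x)       ≡⟨ ax1 x ((x - y) - (((x - x) - y) - y)) ⟩
    x                                               ∎

  [x-x]-y≡x-x : ∀ x y → (x - x) - y ≡ x - x
  [x-x]-y≡x-x x y = begin
    (x - x) - y                                     ≡⟨ cong (λ h → (x - h) - y) (sym (ax1 x (y - y))) ⟩
    (x - (x - ((y - y) - x))) - y                   ≡⟨ cong (_- y) (ax2 x ((y - y) - x)) ⟩
    (((y - y) - x) - (((y - y) - x) - x)) - y       ≡⟨ ax3 ((y - y) - x) (((y - y) - x) - x) y ⟩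
    (((y - y) - x) - y) - (((y - y) - x) - x)       ≡⟨ cong (λ h → (((y - y) - x) - h) - (((y - y) - x) - x)) (sym (ax1 y y)) ⟩
    (((y - y) - x) - (y - (y - y))) - (((y - y) - x) - x) ≡⟨ cong (_- (((y - y) - x) - x)) (sym (ax3 (y - y) (y - (y - y)) x)) ⟩
    (((y - y) - (y - (y - y))) - x) - (((y - y) - x) - x) ≡⟨ cong (λ h → (h - x) - (((y - y) - x) - x)) (ax1 (y - y) y) ⟩
    ((y - y) - x) - (((y - y) - x) - x)             ≡⟨ sym (ax2 x ((y - y) - x)) ⟩
    x - (x - ((y - y) - x))                         ≡⟨ cong (x -_) (ax1 x (y - y)) ⟩
    x - x                                           ∎

  [x-y]-x≡x-x : ∀ x y → (x - y) - x ≡ x - x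
  [x-y]-x≡x-x x y = begin
    (x - y) - x                                     ≡⟨ cong (λ h → (h - y) - x) (sym (ax1 x (x - y))) ⟩
    ((x - ((x - y) - x)) - y) - x                   ≡⟨ cong (_- x) (ax3 x ((x - y) - x) y) ⟩
    ((x - y) - ((x - y) - x)) - x                   ≡⟨ ax3 (x - y) ((x - y) - x) x ⟩
    ((x - y) - x) - ((x - y) - x)                   ≡⟨ cong (((x - y) - x) -_) (sym (ax1 ((x - y) - x) x)) ⟩
    ((x - y) - x) - (((x - y) - x) - (x - ((x - y) - x))) ≡⟨ cong (λ h → ((x - y) - x) - (((x - y) - x) - h)) (ax1 x (x - y)) ⟩
    ((x - y) - x) - (((x - y) - x) - x)             ≡⟨ sym (ax2 x ((x - y) - x)) ⟩
    x - (x - ((x - y) - x))                         ≡⟨ cong (x -_) (ax1 x (x - y)) ⟩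
    x - x                                           ∎

  x-x·y≡x-y : ∀ x y → x - x · y ≡ x - y
  x-x·y≡x-y x y = trans (ax2 x (x - y)) (trans (cong ((x - y) -_) ([x-y]-x≡x-x x y)) (x-[y-y]≡x (x - y) x))

  ≤⇒x-y≡y-y : ∀ {x y} → x ≤ y → x - y ≡ y - y
  ≤⇒x-y≡y-y {x} {y} x≤y = begin
    x - y                 ≡⟨ cong (_- y) (sym x≤y) ⟩
    (x - (x - y)) - y     ≡⟨ ax3 x (x - y) y ⟩
    (x - y) - (x - y)     ≡⟨ x-x≡y-y (x - y) y ⟩
    y - y                 ∎

  x-y≡w-w⇒≤ : ∀ {x y} w → x - y ≡ w - w → x ≤ y
  x-y≡w-w⇒≤ {x} w eq = trans (cong (x -_) eq) (x-[y-y]≡x x w)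

  ≤-refl : ∀ x → x ≤ x
  ≤-refl x = ax1 x x

  ≤-trans : ∀ {x y z} → x ≤ y → y ≤ z → x ≤ z
  ≤-trans {x} {y} {z} x≤y y≤z = x-y≡w-w⇒≤ z (begin
    x - z                 ≡⟨ cong (_- z) (trans (sym x≤y) (ax2 x y)) ⟩
    (y - (y - x)) - z     ≡⟨ ax3 y (y - x) z ⟩
    (y - z) - (y - x)     ≡⟨ cong (_- (y - x)) (≤⇒x-y≡y-y y≤z) ⟩
    (z - z) - (y - x)     ≡⟨ [x-x]-y≡x-x z (y - x) ⟩
    z - z                 ∎)

  ≤-antisym : ∀ {x y} → x ≤ y → y ≤ x → x ≡ y
  ≤-antisym {x} {y} x≤y y≤x = trans (sym x≤y) (trans (ax2 x y) y≤x)

  x·y≤x : ∀ x y → (x · y) ≤ x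
  x·y≤x x y = x-y≡w-w⇒≤ x (trans (ax3 x (x - y) x) ([x-x]-y≡x-x x (x - y)))

  x·y≤y : ∀ x y → (x · y) ≤ y
  x·y≤y x y = subst (_≤ y) (ax2 y x) (x·y≤x y x)

  ·-glb : ∀ {z x y} → z ≤ x → z ≤ y → z ≤ (x · y)
  ·-glb {z} {x} {y} z≤x z≤y = x-y≡w-w⇒≤ y (begin
    z - x · y                   ≡⟨ cong (_- x · y) z≡x·z ⟩
    x · z - x · y               ≡⟨ ax3 x (x - z) (x · y) ⟩
    (x - x · y) - (x - z)       ≡⟨ cong (_- (x - z)) (x-x·y≡x-y x y) ⟩
    (x - y) - (x - z)           ≡⟨ ax3 x y (x - z) ⟩
    x · z - y                   ≡⟨ cong (_- y) (sym z≡x·z) ⟩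
    z - y                       ≡⟨ ≤⇒x-y≡y-y z≤y ⟩
    y - y                       ∎)
    where
    z≡x·z : z ≡ x · z
    z≡x·z = trans (sym z≤x) (ax2 z x)

  ·-mono-≤ : ∀ {a b c d} → a ≤ b → c ≤ d → (a · c) ≤ (b · d)
  ·-mono-≤ {a} {c = c} a≤b c≤d = ·-glb (≤-trans (x·y≤x a c) a≤b) (≤-trans (x·y≤y a c) c≤d)

  w-w≤x : ∀ w x → (w - w) ≤ x
  w-w≤x w x = x-y≡w-w⇒≤ w ([x-x]-y≡x-x w x)

  x≤w-w⇒x≡w-w : ∀ {w x} → x ≤ (w - w) → x ≡ w - w
  x≤w-w⇒x≡w-w {w} {x} x≤0 = ≤-antisym x≤0 (w-w≤x w x)

  ≤⇒x▷y≡x : ∀ {x y} → x ≤ y → x ▷ y ≡ x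
  ≤⇒x▷y≡x {x} {y} x≤y = begin
    x ▷ y         ≡⟨ cong (_▷ y) (sym y·x≡x) ⟩
    (y · x) ▷ y   ≡⟨ ax5 y x ⟩
    y · x         ≡⟨ y·x≡x ⟩
    x             ∎
    where
    y·x≡x : y · x ≡ x
    y·x≡x = trans (ax2 y x) x≤y

  ▷-idem : ∀ x → x ▷ x ≡ x
  ▷-idem x = ≤⇒x▷y≡x (≤-refl x)

  x▷y≤y : ∀ x y → (x ▷ y) ≤ y
  x▷y≤y x y = begin
    u · y                   ≡⟨ sym (ax5 u y) ⟩
    (u · y) ▷ u             ≡⟨ cong (_▷ u) (trans (cong (u ·_) (sym (▷-idem y))) (ax4 x y y)) ⟩
    (u ▷ y) ▷ u             ≡⟨ sym (ax4 u y u) ⟩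
    (u ▷ u) · (y ▷ u)       ≡⟨ cong (_· (y ▷ u)) (▷-idem u) ⟩
    u · (y ▷ u)             ≡⟨ subst (_≤ (y ▷ u)) (trans (ax4 x y u) (▷-idem u)) (x·y≤y (x ▷ u) (y ▷ u)) ⟩
    u                       ∎
    where
    u : Carrier
    u = x ▷ y

  ▷-monoˡ-≤ : ∀ {a b} c → a ≤ b → (a ▷ c) ≤ (b ▷ c)
  ▷-monoˡ-≤ {a} {b} c a≤b = trans (ax4 a b c) (cong (_▷ c) (≤⇒x▷y≡x a≤b))

  ▷-monoʳ-≤ : ∀ a {b c} → b ≤ c → (a ▷ b) ≤ (a ▷ c)
  ▷-monoʳ-≤ a {b} {c} b≤c = subst (_≤ (a ▷ c)) [a▷c]·[b▷c]≡a▷b (x·y≤x (a ▷ c) (b ▷ c))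
    where
    [a▷c]·[b▷c]≡a▷b : (a ▷ c) · (b ▷ c) ≡ a ▷ b
    [a▷c]·[b▷c]≡a▷b = trans (ax4 a b c) (≤⇒x▷y≡x (≤-trans (x▷y≤y a b) b≤c))

  ▷-mono-≤ : ∀ {a b c d} → a ≤ b → c ≤ d → (a ▷ c) ≤ (b ▷ d)
  ▷-mono-≤ {b = b} {c} a≤b c≤d = ≤-trans (▷-monoˡ-≤ c a≤b) (▷-monoʳ-≤ b c≤d)

  x·y≤y▷x : ∀ x y → (x · y) ≤ (y ▷ x)
  x·y≤y▷x x y = begin
    (x · y) · (y ▷ x)               ≡⟨ cong (_· (y ▷ x)) (sym (≤⇒x▷y≡x (x·y≤x x y))) ⟩
    ((x · y) ▷ x) · (y ▷ x)         ≡⟨ ax4 (x · y) y x ⟩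
    ((x · y) ▷ y) ▷ x               ≡⟨ cong (_▷ x) (≤⇒x▷y≡x (x·y≤y x y)) ⟩
    (x · y) ▷ x                     ≡⟨ ≤⇒x▷y≡x (x·y≤x x y) ⟩
    x · y                           ∎

  ≤⇒x·[z▷y]≡z▷x : ∀ {x y} z → x ≤ y → x · (z ▷ y) ≡ z ▷ x
  ≤⇒x·[z▷y]≡z▷x {x} {y} z x≤y = begin
    x · (z ▷ y)             ≡⟨ ax2 x (z ▷ y) ⟩
    (z ▷ y) · x             ≡⟨ cong ((z ▷ y) ·_) (sym (≤⇒x▷y≡x x≤y)) ⟩
    (z ▷ y) · (x ▷ y)       ≡⟨ ax4 z x y ⟩
    (z ▷ x) ▷ y             ≡⟨ ≤⇒x▷y≡x (≤-trans (x▷y≤y z x) x≤y) ⟩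
    z ▷ x                   ∎

  x▷y≡w-w⇒y▷x≡w-w : ∀ {x y w} → x ▷ y ≡ w - w → y ▷ x ≡ w - w
  x▷y≡w-w⇒y▷x≡w-w {x} {y} {w} x▷y≡0 = begin
    y ▷ x                   ≡⟨ sym (x▷y≤y y x) ⟩
    (y ▷ x) · x             ≡⟨ ax2 (y ▷ x) x ⟩
    x · (y ▷ x)             ≡⟨ cong (_· (y ▷ x)) (sym (▷-idem x)) ⟩
    (x ▷ x) · (y ▷ x)       ≡⟨ ax4 x y x ⟩
    (x ▷ y) ▷ x             ≡⟨ cong (_▷ x) x▷y≡0 ⟩
    (w - w) ▷ x             ≡⟨ ≤⇒x▷y≡x (w-w≤x w x) ⟩
    w - w                   ∎

  n·[k▷m]≤w-w⇒[n·m]▷k≡w-w : ∀ {n k m w} → (n · (k ▷ m)) ≤ (w - w) → (n · m) ▷ k ≡ w - w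
  n·[k▷m]≤w-w⇒[n·m]▷k≡w-w {n} {k} {m} n·[k▷m]≤0 = x▷y≡w-w⇒y▷x≡w-w (x≤w-w⇒x≡w-w
    (subst (_≤ _) (≤⇒x·[z▷y]≡z▷x k (x·y≤y n m))
      (≤-trans (·-mono-≤ (x·y≤x n m) (≤-refl (k ▷ m))) n·[k▷m]≤0)))

  open IsFilter

  ▷-closed : ∀ {F} → IsFilter F → ∀ {a b} → F a → F b → F (a ▷ b)
  ▷-closed F-filter {a} {b} Fa Fb = upward F-filter (b · a) (a ▷ b) (meet F-filter b a Fb Fa) (x·y≤y▷x b a)

  w-w∈⇒¬proper : ∀ {F} w → IsFilter F → F (w - w) → ¬ IsProper F
  w-w∈⇒¬proper w F-filter F0 (a , a∉F) = a∉F (upward F-filter (w - w) a F0 (w-w≤x w a))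

  ↑▷ₛ-isFilter : ∀ {μ F} → IsFilter μ → IsFilter F → IsFilter ((μ ▷ₛ F) ↑)
  ↑▷ₛ-isFilter {μ} {F} μ-filter F-filter = record
    { nonempty = let (m , μm) = nonempty μ-filter; (f , Ff) = nonempty F-filter
                 in m ▷ f , (m ▷ f , (m , f , μm , Ff , refl) , ≤-refl (m ▷ f))
    ; upward   = λ { _ _ (y , s , y≤a) a≤b → y , s , ≤-trans y≤a a≤b }
    ; meet     = λ { _ _ (_ , (m₁ , f₁ , μm₁ , Ff₁ , refl) , ≤a) (_ , (m₂ , f₂ , μm₂ , Ff₂ , refl) , ≤b) →
        (m₁ · m₂) ▷ (f₁ · f₂) ,
        (m₁ · m₂ , f₁ · f₂ , meet μ-filter m₁ m₂ μm₁ μm₂ , meet F-filter f₁ f₂ Ff₁ Ff₂ , refl) ,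
        ·-glb (≤-trans (▷-mono-≤ (x·y≤x m₁ m₂) (x·y≤x f₁ f₂)) ≤a)
              (≤-trans (▷-mono-≤ (x·y≤y m₁ m₂) (x·y≤y f₁ f₂)) ≤b) }
    }

  adjoin : Subset → Carrier → Subset
  adjoin μ e x = ∃[ n ] (μ n × (n · e) ≤ x)

  adjoin-isFilter : ∀ {μ} e → IsFilter μ → IsFilter (adjoin μ e)
  adjoin-isFilter e μ-filter = record
    { nonempty = let (m , μm) = nonempty μ-filter in m · e , (m , μm , ≤-refl (m · e))
    ; upward   = λ { _ _ (n , μn , ≤a) a≤b → n , μn , ≤-trans ≤a a≤b }
    ; meet     = λ { _ _ (n₁ , μn₁ , ≤a) (n₂ , μn₂ , ≤b) →
        n₁ · n₂ , meet μ-filter n₁ n₂ μn₁ μn₂ ,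
        ·-glb (≤-trans (·-mono-≤ (x·y≤x n₁ n₂) (≤-refl e)) ≤a)
              (≤-trans (·-mono-≤ (x·y≤y n₁ n₂) (≤-refl e)) ≤b) }
    }

  maximal⇒∈ : ∀ {μ} e w → IsMaximal μ → (∀ n → μ n → ¬ ((n · e) ≤ (w - w))) → μ e
  maximal⇒∈ {μ} e w (μ-filter , _ , μ-max) no-zero =
    μ-max (adjoin μ e) (adjoin-isFilter e μ-filter) (w - w , λ (n , μn , n·e≤0) → no-zero n μn n·e≤0)
          (λ x μx → x , μx , x·y≤x x e) e (m , μm , x·y≤y m e)
    where
    m : Carrier
    m = proj₁ (nonempty μ-filter)

    μm : μ m
    μm = proj₂ (nonempty μ-filter)

  maximal⇒▷∈ : ∀ {μ m} k w → IsMaximal μ → μ m → (∀ n → μ n → ¬ (n ▷ k ≡ w - w)) → μ (k ▷ m)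
  maximal⇒▷∈ {m = m} k w μ-max μm no-zero = maximal⇒∈ (k ▷ m) w μ-max λ n μn n·[k▷m]≤0 →
    no-zero (n · m) (meet (proj₁ μ-max) n m μn μm) (n·[k▷m]≤w-w⇒[n·m]▷k≡w-w n·[k▷m]≤0)

  module _ {μ F : Subset} (μ-max : IsMaximal μ) (F-filter : IsFilter F) where
    private
      μ-filter : IsFilter μ
      μ-filter = proj₁ μ-max

      μ-proper : IsProper μ
      μ-proper = proj₁ (proj₂ μ-max)

      w : Carrier
      w = proj₁ (nonempty μ-filter)

      G : Subset
      G = (μ ▷ₛ F) ↑

      G-filter : IsFilter G
      G-filter = ↑▷ₛ-isFilter μ-filter F-filter

      ▷∈G : ∀ {m f} → μ m → F f → G (m ▷ f)
      ▷∈G {m} {f} μm Ff = m ▷ f , (m , f , μm , Ff , refl) , ≤-refl (m ▷ f)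

    proper⇒maximal : IsProper G → IsMaximal G
    proper⇒maximal G-proper = G-filter , G-proper , G-max
      where
      m : Carrier
      m = proj₁ (nonempty μ-filter)

      μm : μ m
      μm = proj₂ (nonempty μ-filter)

      f : Carrier
      f = proj₁ (nonempty F-filter)

      Ff : F f
      Ff = proj₂ (nonempty F-filter)

      G-max : ∀ H → IsFilter H → IsProper H → G ⊆ H → H ⊆ G
      G-max H H-filter H-proper G⊆H h Hh =
        (k ▷ m) ▷ f , (k ▷ m , f , μ[k▷m] , Ff , refl) , subst (_≤ h) k≡[k▷m]▷f (x·y≤y (m ▷ f) h)
        where
        k : Carrier
        k = (m ▷ f) · h

        k≤f : k ≤ f
        k≤f = ≤-trans (x·y≤x (m ▷ f) h) (x▷y≤y m f)

        Hk : H k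
        Hk = meet H-filter (m ▷ f) h (G⊆H (m ▷ f) (▷∈G μm Ff)) Hh

        μ[k▷m] : μ (k ▷ m)
        μ[k▷m] = maximal⇒▷∈ k w μ-max μm λ n μn n▷k≡0 →
          w-w∈⇒¬proper w H-filter
            (subst H (trans (≤⇒x·[z▷y]≡z▷x n k≤f) n▷k≡0)
               (meet H-filter k (n ▷ f) Hk (G⊆H (n ▷ f) (▷∈G μn Ff))))
            H-proper

        k≡[k▷m]▷f : k ≡ (k ▷ m) ▷ f
        k≡[k▷m]▷f = begin
          k                       ≡⟨ sym (x·y≤x (m ▷ f) h) ⟩
          k · (m ▷ f)             ≡⟨ cong (_· (m ▷ f)) (sym (≤⇒x▷y≡x k≤f)) ⟩
          (k ▷ f) · (m ▷ f)       ≡⟨ ax4 k m f ⟩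
          (k ▷ m) ▷ f             ∎

    proper⇒⪯ : IsProper G → μ ⪯ F
    proper⇒⪯ G-proper _ (f , m , Ff , μm , refl) = maximal⇒▷∈ f w μ-max μm λ n μn n▷f≡0 →
      w-w∈⇒¬proper w G-filter (subst G n▷f≡0 (▷∈G μn Ff)) G-proper

    ⪯⇒proper : μ ⪯ F → IsProper G
    ⪯⇒proper μ⪯F = w - w , w-w∉G
      where
      w-w∉G : ¬ G (w - w)
      w-w∉G (_ , (m , f , μm , Ff , refl) , m▷f≤0) =
        w-w∈⇒¬proper w μ-filter
          (subst μ m·[f▷m]≡w-w (meet μ-filter m (f ▷ m) μm (μ⪯F (f ▷ m) (f , m , Ff , μm , refl))))
          μ-proper
        where
        m·[f▷m]≡w-w : m · (f ▷ m) ≡ w - w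
        m·[f▷m]≡w-w = begin
          m · (f ▷ m)         ≡⟨ cong (_· (f ▷ m)) (sym (▷-idem m)) ⟩
          (m ▷ m) · (f ▷ m)   ≡⟨ ax4 m f m ⟩
          (m ▷ f) ▷ m         ≡⟨ cong (_▷ m) (x≤w-w⇒x≡w-w m▷f≤0) ⟩
          (w - w) ▷ m         ≡⟨ ≤⇒x▷y≡x (w-w≤x w m) ⟩
          w - w               ∎

    ⪯⇒≈ₛ : μ ⪯ F → μ ≈ₛ G
    ⪯⇒≈ₛ μ⪯F = G▷μ⊆μ , μ▷G⊆G
      where
      G▷μ⊆μ : (G ▷ₛ μ) ⊆ μ
      G▷μ⊆μ _ (g , m , (_ , (m₁ , f , μm₁ , Ff , refl) , m₁▷f≤g) , μm , refl) =
        upward μ-filter ((m₁ ▷ f) ▷ m) (g ▷ m)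
          (subst μ (ax4 m₁ f m)
             (meet μ-filter (m₁ ▷ m) (f ▷ m) (▷-closed μ-filter μm₁ μm) (μ⪯F (f ▷ m) (f , m , Ff , μm , refl))))
          (▷-monoˡ-≤ m m₁▷f≤g)
      μ▷G⊆G : (μ ▷ₛ G) ⊆ G
      μ▷G⊆G _ (m , g , μm , (_ , (m₁ , f , μm₁ , Ff , refl) , m₁▷f≤g) , refl) =
        (m₁ ▷ m) ▷ f , (m₁ ▷ m , f , ▷-closed μ-filter μm₁ μm , Ff , refl) ,
        subst (_≤ (m ▷ g)) (sym [m₁▷m]▷f≡m▷[m₁▷f]) (▷-monoʳ-≤ m m₁▷f≤g)
        where
        [m₁▷m]▷f≡m▷[m₁▷f] : (m₁ ▷ m) ▷ f ≡ m ▷ (m₁ ▷ f)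
        [m₁▷m]▷f≡m▷[m₁▷f] = trans (sym (ax4 m₁ m f)) (≤⇒x·[z▷y]≡z▷x m (x▷y≤y m₁ f))

    ≈ₛ⇒⪯ : μ ≈ₛ G → μ ⪯ F
    ≈ₛ⇒⪯ (G▷μ⊆μ , _) _ (f , m , Ff , μm , refl) =
      G▷μ⊆μ (f ▷ m) (f , m , (m ▷ f , (m , f , μm , Ff , refl) , x▷y≤y m f) , μm , refl)

lemma5p5 : ∀ {ℓ : Level} (A : MinusTriAlgebra ℓ) → let open MinusTriAlgebra A in
    (μ F : Subset) → IsMaximal μ → IsFilter F →
      (IsProper ((μ ▷ₛ F) ↑) → IsMaximal ((μ ▷ₛ F) ↑))
      × (IsMaximal ((μ ▷ₛ F) ↑) ⇔ (μ ⪯ F))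
      × ((μ ⪯ F) ⇔ (μ ≈ₛ ((μ ▷ₛ F) ↑)))
lemma5p5 A μ F μ-max F-filter =
    proper⇒maximal μ-max F-filter
  , mk⇔ (proper⇒⪯ μ-max F-filter ∘ proj₁ ∘ proj₂) (proper⇒maximal μ-max F-filter ∘ ⪯⇒proper μ-max F-filter)
  , mk⇔ (⪯⇒≈ₛ μ-max F-filter) (≈ₛ⇒⪯ μ-max F-filter)
  where open Properties A
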